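{- Let $u$ be a set, let $V:u\to\mathbb{N}$, and for $n\in\mathbb{N}$ put $v(n)=\{z\in u\mid V(z)=n\}$ and $v'(n)=\{z\in u\mid V(z)<n\}$. Let $f:\mathcal{P}(u)\to\mathcal{P}(u)$ be a conjunctive set transformer and let $p\subseteq u$ be such that $v(n)\cap p\subseteq f(v'(n))$ for every $n\in\mathbb{N}$ and $p\subseteq f(p)$. Then $p\subseteq\mathrm{fix}(f)$, where $\mathrm{fix}(f)$ is the least fixpoint of $f$.
   Context: A set transformer $f$ on $u$ is conjunctive if it distributes over (nonempty) intersections, e.g. $f(x\cap y)=f(x)\cap f(y)$; in particular it is monotonic, so its least fixpoint exists. -}

module Defs where

open import Level using (0ℓ)
open import Data.Nat using (ℕ; _<_)
open import Data.Product using (_×_)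
open import Relation.Binary.PropositionalEquality using (_≡_)
open import Relation.Unary using (Pred; _⊆_; _≐_; ⋂)

Transformer : Set → Set₁
Transformer u = Pred u 0ℓ → Pred u 0ℓ

-- A set transformer acts on *sets*: it respects extensional equality of subsets.
RespectsExt : {u : Set} → Transformer u → Set₁
RespectsExt {u} f = ∀ (x y : Pred u 0ℓ) → x ≐ y → f x ≐ f y

-- Conjunctive: distributes over all nonempty intersections (index set inhabited).
Conjunctive : {u : Set} → Transformer u → Set₁
Conjunctive {u} f =
  RespectsExt f ×
  (∀ (I : Set) → I → (F : I → Pred u 0ℓ) → f (⋂ I F) ≐ ⋂ I (λ i → f (F i)))

IsLeastFixpoint : {u : Set} → Transformer u → Pred u 0ℓ → Set₁
IsLeastFixpoint {u} f μ = (f μ ≐ μ) × (∀ (q : Pred u 0ℓ) → f q ≐ q → μ ⊆ q)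

v : {u : Set} → (u → ℕ) → ℕ → Pred u 0ℓ
v V n z = V z ≡ n

v′ : {u : Set} → (u → ℕ) → ℕ → Pred u 0ℓ
v′ V n z = V z < n

-- Induction on the variant V: if every point of p below level n is in μ, then a point z ∈ p
-- at level n lies in f (v′ n) ∩ f p = f (v′ n ∩ p) ⊆ f μ = μ, by conjunctivity and monotonicity.
module Submission where

open import Defs
open import Level using (0ℓ)
open import Data.Nat using (ℕ; zero; suc)
open import Data.Nat.Properties using (m<1+n⇒m<n∨m≡n; n<1+n)
open import Data.Bool using (Bool; true; false; if_then_else_)
open import Data.Sum using (inj₁; inj₂)
open import Data.Product using (_,_; proj₁; proj₂)
open import Relation.Unary using (Pred; _⊆_; _∩_; ⋂)

module _ {u : Set} {f : Transformer u} (conj : Conjunctive f) where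

  private
    respects : RespectsExt f
    respects = proj₁ conj

    pair : Pred u 0ℓ → Pred u 0ℓ → Bool → Pred u 0ℓ
    pair a b i = if i then a else b

    ⋂-pair : ∀ a b → f (⋂ Bool (pair a b)) ⊆ ⋂ Bool (λ i → f (pair a b i))
    ⋂-pair a b = proj₁ (proj₂ conj Bool true (pair a b))

    ⋂-pair⁻ : ∀ a b → ⋂ Bool (λ i → f (pair a b i)) ⊆ f (⋂ Bool (pair a b))
    ⋂-pair⁻ a b = proj₂ (proj₂ conj Bool true (pair a b))

  conjunctive⇒∩-preserving : ∀ a b → f a ∩ f b ⊆ f (a ∩ b)
  conjunctive⇒∩-preserving a b (fa , fb) =
    proj₁ (respects (⋂ Bool (pair a b)) (a ∩ b) (to∩ , from∩))
      (⋂-pair⁻ a b λ { true → fa ; false → fb })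
    where
    to∩ : ⋂ Bool (pair a b) ⊆ a ∩ b
    to∩ h = h true , h false
    from∩ : a ∩ b ⊆ ⋂ Bool (pair a b)
    from∩ (x , y) = λ { true → x ; false → y }

  -- If a ⊆ b then a is extensionally a ∩ b, and f (a ∩ b) ⊆ f b.
  conjunctive⇒monotone : ∀ {a b} → a ⊆ b → f a ⊆ f b
  conjunctive⇒monotone {a} {b} a⊆b fa =
    ⋂-pair a b (proj₁ (respects a (⋂ Bool (pair a b)) (to⋂ , λ h → h true)) fa) false
    where
    to⋂ : a ⊆ ⋂ Bool (pair a b)
    to⋂ x = λ { true → x ; false → a⊆b x }

  module _ {V : u → ℕ} {p μ : Pred u 0ℓ}
           (fμ⊆μ : f μ ⊆ μ)
           (level : ∀ n → v V n ∩ p ⊆ f (v′ V n))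
           (p⊆fp : p ⊆ f p) where

    below-level⊆μ : ∀ n → v′ V n ∩ p ⊆ μ
    below-level⊆μ zero    (() , _)
    below-level⊆μ (suc n) (Vz<1+n , pz) with m<1+n⇒m<n∨m≡n Vz<1+n
    ... | inj₁ Vz<n = below-level⊆μ n (Vz<n , pz)
    ... | inj₂ Vz≡n =
      fμ⊆μ (conjunctive⇒monotone (below-level⊆μ n)
              (conjunctive⇒∩-preserving (v′ V n) p (level n (Vz≡n , pz) , p⊆fp pz)))

    ⊆-leastFixpoint : p ⊆ μ
    ⊆-leastFixpoint {z} pz = below-level⊆μ (suc (V z)) (n<1+n (V z) , pz)

theorem3 : (u : Set) (V : u → ℕ) (f : Pred u 0ℓ → Pred u 0ℓ) (p μ : Pred u 0ℓ)
    → Conjunctive f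
    → IsLeastFixpoint f μ
    → (∀ (n : ℕ) → v V n ∩ p ⊆ f (v′ V n))
    → p ⊆ f p
    → p ⊆ μ
theorem3 u V f p μ conj ((fμ⊆μ , _) , _) level p⊆fp =
  ⊆-leastFixpoint conj fμ⊆μ level p⊆fp
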